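{- Consider the signature $\Sigma_U=\{0,-,\mathrm{app},+,\cdot\}$ where $0$ is a constant, $-$ is unary minus, $\mathrm{app}$ is a unary function symbol (unary append, written postfix as $x1$ in the paper, semantically $x+1$), and $+,\cdot$ are binary. Let $N_1$ be the term rewriting system over $\Sigma_U\setminus\{ -\}$ given by the left-to-right oriented equations [U1] $x+0=x$; [U2] $x+\mathrm{app}(y)=\mathrm{app}(x)+y$; [U3] $x\cdot 0=0$; [U4] $x\cdot\mathrm{app}(y)=x+(x\cdot y)$, and let $Z_1$ be the term rewriting system over $\Sigma_U$ consisting of [U1]--[U4] together with [U5] $-0=0$; [U6] $\mathrm{app}(-\mathrm{app}(x))=-x$; [U7] $-(-x)=x$; [U8] $x+(-y)=-((-x)+y)$; [U9] $x\cdot(-y)=-(x\cdot y)$. Then $N_1$ and $Z_1$ are ground-complete.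
   Context: Equations are read as rewrite rules from left to right with variables $x,y$. A term rewriting system is ground-complete if it is strongly terminating (no infinite rewrite sequences) and ground-confluent (confluent on closed terms). -}

module Defs where

open import Data.Nat using (ℕ; suc)
open import Data.Product using (Σ; ∃; _×_)
open import Relation.Nullary using (¬_)
open import Relation.Binary.Construct.Closure.ReflexiveTransitive using (Star)

-- Signatures: N = Σ_U \ {-},  Z = Σ_U = {0, -, app, +, ·}
data Sig : Set where
  N Z : Sig

data Term : Sig → Set where
  var  : ∀ {σ} → ℕ → Term σ
  `0   : ∀ {σ} → Term σ
  app  : ∀ {σ} → Term σ → Term σ
  _⊕_  : ∀ {σ} → Term σ → Term σ → Term σ
  _⊙_  : ∀ {σ} → Term σ → Term σ → Term σ
  neg  : Term Z → Term Z

infixl 6 _⊕_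
infixl 7 _⊙_

data Ground : {σ : Sig} → Term σ → Set where
  g0   : ∀ {σ} → Ground {σ} `0
  gapp : ∀ {σ} {x : Term σ} → Ground x → Ground (app x)
  g⊕   : ∀ {σ} {x y : Term σ} → Ground x → Ground y → Ground (x ⊕ y)
  g⊙   : ∀ {σ} {x y : Term σ} → Ground x → Ground y → Ground (x ⊙ y)
  gneg : ∀ {x : Term Z} → Ground x → Ground {Z} (neg x)

-- Root rewrite steps: all substitution instances of the rules.
-- U1–U4 form N₁ (over Σ_U \ {-}); U1–U9 form Z₁ (over Σ_U).
data Rule : (σ : Sig) → Term σ → Term σ → Set where
  U1 : ∀ {σ} (x : Term σ)   → Rule σ (x ⊕ `0) x
  U2 : ∀ {σ} (x y : Term σ) → Rule σ (x ⊕ app y) (app x ⊕ y)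
  U3 : ∀ {σ} (x : Term σ)   → Rule σ (x ⊙ `0) `0
  U4 : ∀ {σ} (x y : Term σ) → Rule σ (x ⊙ app y) (x ⊕ (x ⊙ y))
  U5 : Rule Z (neg `0) `0
  U6 : (x : Term Z)   → Rule Z (app (neg (app x))) (neg x)
  U7 : (x : Term Z)   → Rule Z (neg (neg x)) x
  U8 : (x y : Term Z) → Rule Z (x ⊕ neg y) (neg (neg x ⊕ y))
  U9 : (x y : Term Z) → Rule Z (x ⊙ neg y) (neg (x ⊙ y))

data _⟶_ : {σ : Sig} → Term σ → Term σ → Set where
  root : ∀ {σ} {l r : Term σ} → Rule σ l r → l ⟶ r
  appc : ∀ {σ} {x x' : Term σ} → x ⟶ x' → app x ⟶ app x'
  ⊕l   : ∀ {σ} {x x' y : Term σ} → x ⟶ x' → (x ⊕ y) ⟶ (x' ⊕ y)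
  ⊕r   : ∀ {σ} {x y y' : Term σ} → y ⟶ y' → (x ⊕ y) ⟶ (x ⊕ y')
  ⊙l   : ∀ {σ} {x x' y : Term σ} → x ⟶ x' → (x ⊙ y) ⟶ (x' ⊙ y)
  ⊙r   : ∀ {σ} {x y y' : Term σ} → y ⟶ y' → (x ⊙ y) ⟶ (x ⊙ y')
  negc : ∀ {x x' : Term Z} → x ⟶ x' → _⟶_ {Z} (neg x) (neg x')

infix 4 _⟶_ _⟶*_

_⟶*_ : ∀ {σ} → Term σ → Term σ → Set
_⟶*_ = Star _⟶_

StronglyTerminating : Sig → Set
StronglyTerminating σ = ¬ (Σ (ℕ → Term σ) λ f → ∀ i → f i ⟶ f (suc i))

GroundConfluent : Sig → Set
GroundConfluent σ = ∀ (t u v : Term σ) → Ground t → t ⟶* u → t ⟶* v →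
  ∃ λ w → (u ⟶* w) × (v ⟶* w)

GroundComplete : Sig → Set
GroundComplete σ = StronglyTerminating σ × GroundConfluent σ

-- Termination: the weight 0 ↦ 1, app x ↦ x + 1, neg x ↦ x + 1, x ⊕ y ↦ x + 3y,
-- x ⊙ y ↦ (x + 1)·4^y is strictly monotone in every argument and strictly decreases
-- under every rule, so it strictly decreases along every rewrite step.
-- Ground confluence: reading app as successor, every rule is an identity of ℕ (U1–U4)
-- resp. ℤ (U1–U9), so rewriting preserves the value of a term; and every ground term
-- rewrites to the numeral of its value (app ⋯ app 0, or neg (app ⋯ app 0) for negative
-- integers). Two reducts of one ground term therefore meet at the same numeral.
module Submission where

open import Defs
open import Data.Product using (_×_; Σ; ∃; _,_)
open import Data.Nat using (ℕ; zero; suc; _+_; _*_; _^_; _<_; z≤n; s≤s)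
open import Data.Nat.Properties
open import Data.Nat.Induction using (<-wellFounded)
open import Data.Nat.Tactic.RingSolver using (solve-∀)
open import Data.Integer as ℤ using (ℤ; -[1+_]; 1ℤ)
import Data.Integer.Properties as ℤ
import Data.Integer.Tactic.RingSolver as ℤ-Solver
open import Function using (_on_; flip; _∘_)
open import Induction.InfiniteDescent using (InfiniteDescendingSequenceFrom; descent∧wf⇒empty)
import Relation.Binary.Construct.On as On
open import Relation.Binary.Construct.Closure.ReflexiveTransitive using (ε; _◅_; _◅◅_; gmap)
open import Relation.Binary.Construct.Closure.ReflexiveTransitive.Properties using (module StarReasoning)
open import Relation.Binary.PropositionalEquality using (_≡_; refl; sym; trans; cong; subst)
open import Relation.Nullary using (¬_)

module _ {A : Set} (_⇒_ : A → A → Set) (μ : A → ℕ) (μ-decreasing : ∀ {s t} → s ⇒ t → μ t < μ s) where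

  decreasingMeasure⇒noInfiniteChain : ¬ Σ (ℕ → A) λ f → ∀ i → f i ⇒ f (suc i)
  decreasingMeasure⇒noInfiniteChain (f , chain) =
    descent∧wf⇒empty descent (On.wellFounded μ <-wellFounded) (f 0) (f , refl , chain)
    where
    descent : ∀ {x} → ∃ (λ g → InfiniteDescendingSequenceFrom (flip _⇒_) g x) →
              ∃ λ y → (_<_ on μ) y x × ∃ (λ g → InfiniteDescendingSequenceFrom (flip _⇒_) g y)
    descent (g , refl , chain) = g 1 , μ-decreasing (chain 0) , g ∘ suc , refl , chain ∘ suc

weight : ∀ {σ} → Term σ → ℕ
weight (var _) = 0
weight `0      = 1
weight (app x) = suc (weight x)
weight (x ⊕ y) = weight x + 3 * weight y
weight (x ⊙ y) = suc (weight x) * 4 ^ weight y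
weight (neg x) = suc (weight x)

n≡1+m+k⇒m<n : ∀ {m n} k → n ≡ suc (m + k) → m < n
n≡1+m+k⇒m<n {m} k refl = s≤s (m≤m+n m k)

⊙app-weight< : ∀ x w → 0 < w → x + 3 * (suc x * w) < suc x * (4 * w)
⊙app-weight< x (suc w) _ = n≡1+m+k⇒m<n (w + x * w) (solve x w)
  where
  solve : ∀ x w → suc x * (4 * suc w) ≡ suc (x + 3 * (suc x * suc w) + (w + x * w))
  solve = solve-∀

⊙neg-weight< : ∀ x w → 0 < w → suc (suc x * w) < suc x * (4 * w)
⊙neg-weight< x (suc w) _ = n≡1+m+k⇒m<n (1 + 3 * w + 3 * x + 3 * x * w) (solve x w)
  where
  solve : ∀ x w → suc x * (4 * suc w) ≡ suc (suc (suc x * suc w) + (1 + 3 * w + 3 * x + 3 * x * w))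
  solve = solve-∀

rule-weight< : ∀ {σ} {l r : Term σ} → Rule σ l r → weight r < weight l
rule-weight< (U1 x)   = n≡1+m+k⇒m<n 2 (solve (weight x))
  where
  solve : ∀ x → x + 3 * 1 ≡ suc (x + 2)
  solve = solve-∀
rule-weight< (U2 x y) = n≡1+m+k⇒m<n 1 (solve (weight x) (weight y))
  where
  solve : ∀ x y → x + 3 * suc y ≡ suc (suc x + 3 * y + 1)
  solve = solve-∀
rule-weight< (U3 x)   = n≡1+m+k⇒m<n (2 + 4 * weight x) (solve (weight x))
  where
  solve : ∀ x → suc x * (4 * 1) ≡ suc (1 + (2 + 4 * x))
  solve = solve-∀
rule-weight< (U4 x y) = ⊙app-weight< (weight x) (4 ^ weight y) (m^n>0 4 (weight y))
rule-weight< U5       = n<1+n 1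
rule-weight< (U6 x)   = m<n⇒m<1+n (n<1+n _)
rule-weight< (U7 x)   = m<n⇒m<1+n (n<1+n _)
rule-weight< (U8 x y) = n≡1+m+k⇒m<n 0 (solve (weight x) (weight y))
  where
  solve : ∀ x y → x + 3 * suc y ≡ suc (suc (suc x) + 3 * y + 0)
  solve = solve-∀
rule-weight< (U9 x y) = ⊙neg-weight< (weight x) (4 ^ weight y) (m^n>0 4 (weight y))

step-weight< : ∀ {σ} {s t : Term σ} → s ⟶ t → weight t < weight s
step-weight< (root r)         = rule-weight< r
step-weight< (appc p)         = s≤s (step-weight< p)
step-weight< (⊕l {y = y} p)   = +-monoˡ-< (3 * weight y) (step-weight< p)
step-weight< (⊕r {x = x} p)   = +-monoʳ-< (weight x) (*-monoʳ-< 3 (step-weight< p))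
step-weight< (⊙l {y = y} p)   = *-monoˡ-< (4 ^ weight y) {{m^n≢0 4 (weight y)}} (s≤s (step-weight< p))
step-weight< (⊙r {x = x} p)   = *-monoʳ-< (suc (weight x)) (^-monoʳ-< 4 (s≤s (s≤s z≤n)) (step-weight< p))
step-weight< (negc p)         = s≤s (step-weight< p)

stronglyTerminating : ∀ σ → StronglyTerminating σ
stronglyTerminating σ = decreasingMeasure⇒noInfiniteChain _⟶_ weight step-weight<

app-⟶* : ∀ {σ} {x x' : Term σ} → x ⟶* x' → app x ⟶* app x'
app-⟶* = gmap app appc

neg-⟶* : {x x' : Term Z} → x ⟶* x' → neg x ⟶* neg x'
neg-⟶* = gmap neg negc

⊕-⟶* : ∀ {σ} {x x' y y' : Term σ} → x ⟶* x' → y ⟶* y' → x ⊕ y ⟶* x' ⊕ y'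
⊕-⟶* p q = gmap _ ⊕l p ◅◅ gmap _ ⊕r q

⊙-⟶* : ∀ {σ} {x x' y y' : Term σ} → x ⟶* x' → y ⟶* y' → x ⊙ y ⟶* x' ⊙ y'
⊙-⟶* p q = gmap _ ⊙l p ◅◅ gmap _ ⊙r q

rule-ground : ∀ {σ} {l r : Term σ} → Rule σ l r → Ground l → Ground r
rule-ground (U1 x)   (g⊕ gx g0)                = gx
rule-ground (U2 x y) (g⊕ gx (gapp gy))         = g⊕ (gapp gx) gy
rule-ground (U3 x)   (g⊙ gx g0)                = g0
rule-ground (U4 x y) (g⊙ gx (gapp gy))         = g⊕ gx (g⊙ gx gy)
rule-ground U5       (gneg g0)                 = g0
rule-ground (U6 x)   (gapp (gneg (gapp gx)))   = gneg gx
rule-ground (U7 x)   (gneg (gneg gx))          = gx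
rule-ground (U8 x y) (g⊕ gx (gneg gy))         = gneg (g⊕ (gneg gx) gy)
rule-ground (U9 x y) (g⊙ gx (gneg gy))         = gneg (g⊙ gx gy)

step-ground : ∀ {σ} {t u : Term σ} → t ⟶ u → Ground t → Ground u
step-ground (root r) g         = rule-ground r g
step-ground (appc p) (gapp g)  = gapp (step-ground p g)
step-ground (⊕l p)   (g⊕ g h)  = g⊕ (step-ground p g) h
step-ground (⊕r p)   (g⊕ g h)  = g⊕ g (step-ground p h)
step-ground (⊙l p)   (g⊙ g h)  = g⊙ (step-ground p g) h
step-ground (⊙r p)   (g⊙ g h)  = g⊙ g (step-ground p h)
step-ground (negc p) (gneg g)  = gneg (step-ground p g)

steps-ground : ∀ {σ} {t u : Term σ} → t ⟶* u → Ground t → Ground u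
steps-ground ε        g = g
steps-ground (p ◅ ps) g = steps-ground ps (step-ground p g)

module _ {σ} {V : Set} (eval : Term σ → V) (numeral : V → Term σ)
         (step-eval : ∀ {s t} → s ⟶ t → eval s ≡ eval t)
         (normalise : ∀ {t} → Ground t → t ⟶* numeral (eval t)) where

  steps-eval : ∀ {s t} → s ⟶* t → eval s ≡ eval t
  steps-eval ε        = refl
  steps-eval (p ◅ ps) = trans (step-eval p) (steps-eval ps)

  groundConfluent-byEvaluation : GroundConfluent σ
  groundConfluent-byEvaluation t u v g t⟶*u t⟶*v =
    numeral (eval t) , reduct-normalises t⟶*u , reduct-normalises t⟶*v
    where
    reduct-normalises : ∀ {w} → t ⟶* w → w ⟶* numeral (eval t)
    reduct-normalises t⟶*w =
      subst (λ k → _ ⟶* numeral k) (sym (steps-eval t⟶*w)) (normalise (steps-ground t⟶*w g))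

⌜_⌝ : ∀ {σ} → ℕ → Term σ
⌜ zero ⌝  = `0
⌜ suc n ⌝ = app ⌜ n ⌝

evalℕ : Term N → ℕ
evalℕ (var _) = 0
evalℕ `0      = 0
evalℕ (app x) = suc (evalℕ x)
evalℕ (x ⊕ y) = evalℕ x + evalℕ y
evalℕ (x ⊙ y) = evalℕ x * evalℕ y

rule-evalℕ : ∀ {l r : Term N} → Rule N l r → evalℕ l ≡ evalℕ r
rule-evalℕ (U1 x)   = +-identityʳ (evalℕ x)
rule-evalℕ (U2 x y) = +-suc (evalℕ x) (evalℕ y)
rule-evalℕ (U3 x)   = *-zeroʳ (evalℕ x)
rule-evalℕ (U4 x y) = *-suc (evalℕ x) (evalℕ y)

step-evalℕ : ∀ {l r : Term N} → l ⟶ r → evalℕ l ≡ evalℕ r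
step-evalℕ (root r)       = rule-evalℕ r
step-evalℕ (appc p)       = cong suc (step-evalℕ p)
step-evalℕ (⊕l {y = y} p) = cong (_+ evalℕ y) (step-evalℕ p)
step-evalℕ (⊕r {x = x} p) = cong (evalℕ x +_) (step-evalℕ p)
step-evalℕ (⊙l {y = y} p) = cong (_* evalℕ y) (step-evalℕ p)
step-evalℕ (⊙r {x = x} p) = cong (evalℕ x *_) (step-evalℕ p)

module _ where
  open StarReasoning (_⟶_ {N})

  ⌜⌝-+ : ∀ a b → _⟶*_ {N} (⌜ a ⌝ ⊕ ⌜ b ⌝) ⌜ a + b ⌝
  ⌜⌝-+ a zero = begin
    ⌜ a ⌝ ⊕ `0            ⟶⟨ root (U1 _) ⟩
    ⌜ a ⌝                 ≡⟨ cong ⌜_⌝ (sym (+-identityʳ a)) ⟩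
    ⌜ a + 0 ⌝             ∎
  ⌜⌝-+ a (suc b) = begin
    ⌜ a ⌝ ⊕ ⌜ suc b ⌝     ⟶⟨ root (U2 _ _) ⟩
    ⌜ suc a ⌝ ⊕ ⌜ b ⌝     ⟶*⟨ ⌜⌝-+ (suc a) b ⟩
    ⌜ suc a + b ⌝         ≡⟨ cong ⌜_⌝ (sym (+-suc a b)) ⟩
    ⌜ a + suc b ⌝         ∎

  ⌜⌝-* : ∀ a b → _⟶*_ {N} (⌜ a ⌝ ⊙ ⌜ b ⌝) ⌜ a * b ⌝
  ⌜⌝-* a zero = begin
    ⌜ a ⌝ ⊙ `0            ⟶⟨ root (U3 _) ⟩
    `0                    ≡⟨ cong ⌜_⌝ (sym (*-zeroʳ a)) ⟩
    ⌜ a * 0 ⌝             ∎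
  ⌜⌝-* a (suc b) = begin
    ⌜ a ⌝ ⊙ ⌜ suc b ⌝     ⟶⟨ root (U4 _ _) ⟩
    ⌜ a ⌝ ⊕ ⌜ a ⌝ ⊙ ⌜ b ⌝ ⟶*⟨ ⊕-⟶* ε (⌜⌝-* a b) ⟩
    ⌜ a ⌝ ⊕ ⌜ a * b ⌝     ⟶*⟨ ⌜⌝-+ a (a * b) ⟩
    ⌜ a + a * b ⌝         ≡⟨ cong ⌜_⌝ (sym (*-suc a b)) ⟩
    ⌜ a * suc b ⌝         ∎

normaliseℕ : ∀ {t : Term N} → Ground t → t ⟶* ⌜ evalℕ t ⌝
normaliseℕ g0       = ε
normaliseℕ (gapp g) = app-⟶* (normaliseℕ g)
normaliseℕ (g⊕ g h) = ⊕-⟶* (normaliseℕ g) (normaliseℕ h) ◅◅ ⌜⌝-+ _ _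
normaliseℕ (g⊙ g h) = ⊙-⟶* (normaliseℕ g) (normaliseℕ h) ◅◅ ⌜⌝-* _ _

evalℤ : Term Z → ℤ
evalℤ (var _) = ℤ.+ 0
evalℤ `0      = ℤ.+ 0
evalℤ (app x) = ℤ.suc (evalℤ x)
evalℤ (x ⊕ y) = evalℤ x ℤ.+ evalℤ y
evalℤ (x ⊙ y) = evalℤ x ℤ.* evalℤ y
evalℤ (neg x) = ℤ.- evalℤ x

rule-evalℤ : ∀ {l r : Term Z} → Rule Z l r → evalℤ l ≡ evalℤ r
rule-evalℤ (U1 x)   = ℤ.+-identityʳ (evalℤ x)
rule-evalℤ (U2 x y) = solve (evalℤ x) (evalℤ y)
  where
  solve : ∀ x y → x ℤ.+ (1ℤ ℤ.+ y) ≡ (1ℤ ℤ.+ x) ℤ.+ y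
  solve = ℤ-Solver.solve-∀
rule-evalℤ (U3 x)   = ℤ.*-zeroʳ (evalℤ x)
rule-evalℤ (U4 x y) = solve (evalℤ x) (evalℤ y)
  where
  solve : ∀ x y → x ℤ.* (1ℤ ℤ.+ y) ≡ x ℤ.+ x ℤ.* y
  solve = ℤ-Solver.solve-∀
rule-evalℤ U5       = refl
rule-evalℤ (U6 x)   = solve (evalℤ x)
  where
  solve : ∀ x → 1ℤ ℤ.+ ℤ.- (1ℤ ℤ.+ x) ≡ ℤ.- x
  solve = ℤ-Solver.solve-∀
rule-evalℤ (U7 x)   = ℤ.neg-involutive (evalℤ x)
rule-evalℤ (U8 x y) = solve (evalℤ x) (evalℤ y)
  where
  solve : ∀ x y → x ℤ.+ ℤ.- y ≡ ℤ.- (ℤ.- x ℤ.+ y)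
  solve = ℤ-Solver.solve-∀
rule-evalℤ (U9 x y) = sym (ℤ.neg-distribʳ-* (evalℤ x) (evalℤ y))

step-evalℤ : ∀ {l r : Term Z} → l ⟶ r → evalℤ l ≡ evalℤ r
step-evalℤ (root r)       = rule-evalℤ r
step-evalℤ (appc p)       = cong ℤ.suc (step-evalℤ p)
step-evalℤ (⊕l {y = y} p) = cong (ℤ._+ evalℤ y) (step-evalℤ p)
step-evalℤ (⊕r {x = x} p) = cong (λ v → evalℤ x ℤ.+ v) (step-evalℤ p)
step-evalℤ (⊙l {y = y} p) = cong (ℤ._* evalℤ y) (step-evalℤ p)
step-evalℤ (⊙r {x = x} p) = cong (evalℤ x ℤ.*_) (step-evalℤ p)
step-evalℤ (negc p)       = cong ℤ.-_ (step-evalℤ p)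

⌜_⌝ᶻ : ℤ → Term Z
⌜ ℤ.+ n ⌝ᶻ    = ⌜ n ⌝
⌜ -[1+ n ] ⌝ᶻ = neg ⌜ suc n ⌝

module _ where
  open StarReasoning (_⟶_ {Z})

  ⌜⌝ᶻ-suc : ∀ k → app ⌜ k ⌝ᶻ ⟶* ⌜ ℤ.suc k ⌝ᶻ
  ⌜⌝ᶻ-suc (ℤ.+ n)          = ε
  ⌜⌝ᶻ-suc -[1+ zero ]      = root (U6 _) ◅ root U5 ◅ ε
  ⌜⌝ᶻ-suc -[1+ suc n ]     = root (U6 _) ◅ ε

  ⌜⌝ᶻ-neg : ∀ k → neg ⌜ k ⌝ᶻ ⟶* ⌜ ℤ.- k ⌝ᶻ
  ⌜⌝ᶻ-neg (ℤ.+ zero)       = root U5 ◅ ε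
  ⌜⌝ᶻ-neg (ℤ.+ suc n)      = ε
  ⌜⌝ᶻ-neg -[1+ n ]         = root (U7 _) ◅ ε

  ⌜⌝ᶻ-+ℕ : ∀ a n → ⌜ a ⌝ᶻ ⊕ ⌜ n ⌝ ⟶* ⌜ a ℤ.+ ℤ.+ n ⌝ᶻ
  ⌜⌝ᶻ-+ℕ a zero = begin
    ⌜ a ⌝ᶻ ⊕ `0                      ⟶⟨ root (U1 _) ⟩
    ⌜ a ⌝ᶻ                           ≡⟨ cong ⌜_⌝ᶻ (sym (ℤ.+-identityʳ a)) ⟩
    ⌜ a ℤ.+ ℤ.+ 0 ⌝ᶻ                 ∎
  ⌜⌝ᶻ-+ℕ a (suc n) = begin
    ⌜ a ⌝ᶻ ⊕ ⌜ suc n ⌝               ⟶⟨ root (U2 _ _) ⟩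
    app ⌜ a ⌝ᶻ ⊕ ⌜ n ⌝               ⟶*⟨ ⊕-⟶* (⌜⌝ᶻ-suc a) ε ⟩
    ⌜ ℤ.suc a ⌝ᶻ ⊕ ⌜ n ⌝             ⟶*⟨ ⌜⌝ᶻ-+ℕ (ℤ.suc a) n ⟩
    ⌜ ℤ.suc a ℤ.+ ℤ.+ n ⌝ᶻ           ≡⟨ cong ⌜_⌝ᶻ (solve a (ℤ.+ n)) ⟩
    ⌜ a ℤ.+ ℤ.+ suc n ⌝ᶻ             ∎
    where
    solve : ∀ a m → (1ℤ ℤ.+ a) ℤ.+ m ≡ a ℤ.+ (1ℤ ℤ.+ m)
    solve = ℤ-Solver.solve-∀

  ⌜⌝ᶻ-+ : ∀ a b → ⌜ a ⌝ᶻ ⊕ ⌜ b ⌝ᶻ ⟶* ⌜ a ℤ.+ b ⌝ᶻ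
  ⌜⌝ᶻ-+ a (ℤ.+ n)  = ⌜⌝ᶻ-+ℕ a n
  ⌜⌝ᶻ-+ a -[1+ n ] = begin
    ⌜ a ⌝ᶻ ⊕ neg ⌜ suc n ⌝           ⟶⟨ root (U8 _ _) ⟩
    neg (neg ⌜ a ⌝ᶻ ⊕ ⌜ suc n ⌝)     ⟶*⟨ neg-⟶* (⊕-⟶* (⌜⌝ᶻ-neg a) ε) ⟩
    neg (⌜ ℤ.- a ⌝ᶻ ⊕ ⌜ suc n ⌝)     ⟶*⟨ neg-⟶* (⌜⌝ᶻ-+ℕ (ℤ.- a) (suc n)) ⟩
    neg ⌜ ℤ.- a ℤ.+ ℤ.+ suc n ⌝ᶻ     ⟶*⟨ ⌜⌝ᶻ-neg (ℤ.- a ℤ.+ ℤ.+ suc n) ⟩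
    ⌜ ℤ.- (ℤ.- a ℤ.+ ℤ.+ suc n) ⌝ᶻ   ≡⟨ cong ⌜_⌝ᶻ (solve a (ℤ.+ suc n)) ⟩
    ⌜ a ℤ.+ -[1+ n ] ⌝ᶻ              ∎
    where
    solve : ∀ a m → ℤ.- (ℤ.- a ℤ.+ m) ≡ a ℤ.+ ℤ.- m
    solve = ℤ-Solver.solve-∀

  ⌜⌝ᶻ-*ℕ : ∀ a n → ⌜ a ⌝ᶻ ⊙ ⌜ n ⌝ ⟶* ⌜ a ℤ.* ℤ.+ n ⌝ᶻ
  ⌜⌝ᶻ-*ℕ a zero = begin
    ⌜ a ⌝ᶻ ⊙ `0                      ⟶⟨ root (U3 _) ⟩
    `0                               ≡⟨ cong ⌜_⌝ᶻ (sym (ℤ.*-zeroʳ a)) ⟩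
    ⌜ a ℤ.* ℤ.+ 0 ⌝ᶻ                 ∎
  ⌜⌝ᶻ-*ℕ a (suc n) = begin
    ⌜ a ⌝ᶻ ⊙ ⌜ suc n ⌝               ⟶⟨ root (U4 _ _) ⟩
    ⌜ a ⌝ᶻ ⊕ ⌜ a ⌝ᶻ ⊙ ⌜ n ⌝          ⟶*⟨ ⊕-⟶* ε (⌜⌝ᶻ-*ℕ a n) ⟩
    ⌜ a ⌝ᶻ ⊕ ⌜ a ℤ.* ℤ.+ n ⌝ᶻ        ⟶*⟨ ⌜⌝ᶻ-+ a (a ℤ.* ℤ.+ n) ⟩
    ⌜ a ℤ.+ a ℤ.* ℤ.+ n ⌝ᶻ           ≡⟨ cong ⌜_⌝ᶻ (solve a (ℤ.+ n)) ⟩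
    ⌜ a ℤ.* ℤ.+ suc n ⌝ᶻ             ∎
    where
    solve : ∀ a m → a ℤ.+ a ℤ.* m ≡ a ℤ.* (1ℤ ℤ.+ m)
    solve = ℤ-Solver.solve-∀

  ⌜⌝ᶻ-* : ∀ a b → ⌜ a ⌝ᶻ ⊙ ⌜ b ⌝ᶻ ⟶* ⌜ a ℤ.* b ⌝ᶻ
  ⌜⌝ᶻ-* a (ℤ.+ n)  = ⌜⌝ᶻ-*ℕ a n
  ⌜⌝ᶻ-* a -[1+ n ] = begin
    ⌜ a ⌝ᶻ ⊙ neg ⌜ suc n ⌝           ⟶⟨ root (U9 _ _) ⟩
    neg (⌜ a ⌝ᶻ ⊙ ⌜ suc n ⌝)         ⟶*⟨ neg-⟶* (⌜⌝ᶻ-*ℕ a (suc n)) ⟩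
    neg ⌜ a ℤ.* ℤ.+ suc n ⌝ᶻ         ⟶*⟨ ⌜⌝ᶻ-neg (a ℤ.* ℤ.+ suc n) ⟩
    ⌜ ℤ.- (a ℤ.* ℤ.+ suc n) ⌝ᶻ       ≡⟨ cong ⌜_⌝ᶻ (ℤ.neg-distribʳ-* a (ℤ.+ suc n)) ⟩
    ⌜ a ℤ.* -[1+ n ] ⌝ᶻ              ∎

normaliseℤ : ∀ {t : Term Z} → Ground t → t ⟶* ⌜ evalℤ t ⌝ᶻ
normaliseℤ g0                   = ε
normaliseℤ (gapp {x = x} g)     = app-⟶* (normaliseℤ g) ◅◅ ⌜⌝ᶻ-suc (evalℤ x)
normaliseℤ (g⊕ {x = x} {y} g h) = ⊕-⟶* (normaliseℤ g) (normaliseℤ h) ◅◅ ⌜⌝ᶻ-+ (evalℤ x) (evalℤ y)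
normaliseℤ (g⊙ {x = x} {y} g h) = ⊙-⟶* (normaliseℤ g) (normaliseℤ h) ◅◅ ⌜⌝ᶻ-* (evalℤ x) (evalℤ y)
normaliseℤ (gneg {x = x} g)     = neg-⟶* (normaliseℤ g) ◅◅ ⌜⌝ᶻ-neg (evalℤ x)

theorem3p1p2 : GroundComplete N × GroundComplete Z
theorem3p1p2 =
  (stronglyTerminating N , groundConfluent-byEvaluation evalℕ ⌜_⌝ step-evalℕ normaliseℕ) ,
  (stronglyTerminating Z , groundConfluent-byEvaluation evalℤ ⌜_⌝ᶻ step-evalℤ normaliseℤ)
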